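{- Let $p$ be an odd prime, $G$ a finite $p$-group, $c$ an automorphism of $G$ of order $2$, and $G^+ = \{g \in G: g^c = g\}$. If $G^+ \ne G$, then $G$ has a subgroup $H$ such that $G^+ \le H$, $[G:H] = p$, $H$ is normal in $G$, and $H^c = H$. -}

module Defs where

open import Data.Nat using (ℕ; _^_)
open import Data.Fin using (Fin)
open import Data.Fin.Subset using (Subset; _∈_)
open import Data.Product using (Σ; ∃; _×_)
open import Relation.Binary.PropositionalEquality using (_≡_)
open import Relation.Nullary using (¬_)
open import Algebra.Core using (Op₁; Op₂)
open import Algebra.Structures using (IsGroup)
open import Function.Definitions using (Bijective)

-- A finite group, presented (up to isomorphism) on the carrier Fin n,
-- with propositional equality.
record FiniteGroup : Set where
  field
    n       : ℕ
    _∙_     : Op₂ (Fin n)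
    ε       : Fin n
    _⁻¹     : Op₁ (Fin n)
    isGroup : IsGroup _≡_ _∙_ ε _⁻¹

module _ (G : FiniteGroup) where
  open FiniteGroup G

  IsPGroup : ℕ → Set
  IsPGroup p = ∃ λ k → n ≡ p ^ k

  IsAutomorphism : (Fin n → Fin n) → Set
  IsAutomorphism c = (∀ x y → c (x ∙ y) ≡ c x ∙ c y) × Bijective _≡_ _≡_ c

  HasOrder2 : (Fin n → Fin n) → Set
  HasOrder2 c = (∀ g → c (c g) ≡ g) × ¬ (∀ g → c g ≡ g)

  InFixed : (Fin n → Fin n) → Fin n → Set
  InFixed c g = c g ≡ g

  IsSubgroup : Subset n → Set
  IsSubgroup H = (ε ∈ H) × (∀ x y → x ∈ H → y ∈ H → (x ∙ y) ∈ H)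
                 × (∀ x → x ∈ H → (x ⁻¹) ∈ H)

  IsNormal : Subset n → Set
  IsNormal H = ∀ g h → h ∈ H → ((g ∙ h) ∙ (g ⁻¹)) ∈ H

  InImage : (Fin n → Fin n) → Subset n → Fin n → Set
  InImage c H x = Σ (Fin n) λ h → (h ∈ H) × (c h ≡ x)

{-# OPTIONS --safe #-}

-- Call a subgroup H admissible if it is c-stable, proper and contains G⁺; G⁺ itself is one.
-- If an admissible H is not normal, its normaliser is a strictly larger admissible subgroup:
-- H acts on its left cosets, the fixed cosets rH are those with r normalising H, their number
-- is ≡ [G:H] ≡ 0 (mod p), and H itself is one of them.
-- If H is normal, c induces an automorphism of G/H without nontrivial fixed points: c restricted
-- to a c-stable coset zH, of odd size |H|, has a fixed point, which lies in G⁺ ⊆ H. Hence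
-- x ↦ x⁻¹c(x) is injective, so surjective, on G/H, and c inverts G/H. Every subgroup between
-- H and G is then c-stable; for h ∉ H with hᵖ ∈ H the subgroup ⟨h⟩H is either G, forcing
-- [G:H] = p, or a strictly larger admissible subgroup. As admissible subgroups cannot grow
-- forever, some admissible H is normal of index p.

module Submission where

open import Defs
open import Data.Nat using (ℕ; _*_; _%_)
open import Data.Nat.Primality using (Prime)
open import Data.Fin using (Fin)
open import Data.Fin.Subset using (Subset; _∈_; ∣_∣)
open import Data.Product using (Σ; _×_)
open import Relation.Binary.PropositionalEquality using (_≡_)
open import Relation.Nullary using (¬_)

open import Level using (Level; 0ℓ; _⊔_)
open import Algebra.Bundles using (Group)
open import Algebra.Core using (Op₁; Op₂)
open import Data.Bool.Base using (if_then_else_)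
open import Data.Fin.Base using (zero; suc; toℕ; fromℕ<; Fin′; inject)
import Data.Fin.Base as Fin
open import Data.Fin.Permutation using (Permutation; permutation; _⟨$⟩ʳ_)
open import Data.Fin.Properties
  using (_≟_; any?; all?; suc-injective; toℕ-fromℕ<; toℕ-inject; toℕ≤pred[n]; pigeonhole; ¬∀⟶∃¬-smallest; ¬∀⟶∃¬)
import Data.Fin.Properties as Finₚ
open import Data.Maybe.Base using (Maybe; just; nothing; fromMaybe)
import Data.Maybe.Base as Maybe
open import Data.Nat.Base using (zero; suc; _+_; _∸_; _≤_; _<_; z≤n; s≤s; NonZero; >-nonZero; nonTrivial⇒n>1)
import Data.Nat.Base as ℕ
open import Data.Nat.Coprimality using (Coprime; coprime-divisor)
open import Data.Nat.Divisibility using (_∣_; divides; _∣?_; ∣-trans; ∣⇒≤; ∣1⇒≡1; ∣m+n∣m⇒∣n; n∣m*n)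
open import Data.Nat.DivMod using (_/_; m≡m%n+[m/n]*n; m%n<n)
open import Data.Nat.Primality using (prime⇒irreducible; prime⇒nonTrivial; prime⇒nonZero; ¬prime[1])
open import Data.Nat.Properties
  using ( +-*-semiring; +-identityʳ; +-comm; +-suc; *-comm; suc-pred; m≤m+n; m≤n+m; m<m+n; m∸n≤m; m+[n∸m]≡n
        ; n<1+n; ≤-trans; ≤-reflexive; ≤-antisym; <-≤-trans; +-monoˡ-≤; +-cancelˡ-≤; n≤0⇒n≡0; n≢0⇒n>0; >⇒≢; ≮⇒≥
        ; module ≤-Reasoning)
open import Data.Product using (∃; _,_; proj₁; proj₂)
import Data.Product as Product
open import Data.Sum.Base using (_⊎_; inj₁; inj₂; [_,_]′)
import Data.Sum.Base as Sum
open import Data.Vec.Base using (tabulate)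
open import Data.Vec.Properties using (lookup∘tabulate; lookup⇒[]=; []=⇒lookup)
open import Function.Base using (_∘_)
open import Function.Bundles using (mk⇔)
open import Function.Definitions using (Injective)
open import Relation.Binary.Core using (Rel)
open import Relation.Binary.Definitions using (Symmetric; Transitive; tri<; tri≈; tri>)
import Relation.Binary.Definitions as B
open import Relation.Binary.PropositionalEquality
  using (_≢_; refl; sym; trans; cong; cong₂; subst; subst₂; module ≡-Reasoning)
open import Relation.Nullary.Decidable
  using (Dec; yes; no; does; _×-dec_; _⊎-dec_; _→-dec_; ¬?; dec-true; dec-false; does-⇔; decidable-stable)
open import Relation.Nullary.Negation using (contradiction)
open import Relation.Unary using (Pred; Decidable; _⊆_; _≐_)
open import Relation.Unary.Properties using (U?; ∁?; _∩?_; _∪?_)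
open import Algebra.Properties.Semiring.Sum +-*-semiring
  using (sum-syntax; sum-cong-≗; sum-replicate-zero; ∑-distrib-+; ∑-comm; ∑-permute; *-distribʳ-sum)

private variable
  ℓ ℓ′ : Level
  m k : ℕ
  A B : Set ℓ

-- Counting decidable subsets of Fin m

indicator : Dec A → ℕ
indicator a? = if does a? then 1 else 0

count : {P : Pred (Fin m) ℓ} → Decidable P → ℕ
count {m = m} P? = ∑[ i < m ] indicator (P? i)

module _ {P : Pred (Fin m) ℓ} (P? : Decidable P) where

  count-∅ : (∀ x → ¬ P x) → count P? ≡ 0
  count-∅ ¬P = trans (sum-cong-≗ (λ x → cong (λ b → if b then 1 else 0) (dec-false (P? x) (¬P x))))
                     (sum-replicate-zero m)

  count-cong : {Q : Pred (Fin m) ℓ′} (Q? : Decidable Q) → P ≐ Q → count P? ≡ count Q?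
  count-cong Q? (P⊆Q , Q⊆P) =
    sum-cong-≗ (λ x → cong (λ b → if b then 1 else 0) (does-⇔ (mk⇔ P⊆Q Q⊆P) (P? x) (Q? x)))

  count-permute : (π : Permutation m m) → count (P? ∘ (π ⟨$⟩ʳ_)) ≡ count P?
  count-permute π = sym (∑-permute (indicator ∘ P?) π)

  count-split : {Q : Pred (Fin m) ℓ′} (Q? : Decidable Q) →
                count P? ≡ count (P? ∩? Q?) + count (P? ∩? ∁? Q?)
  count-split Q? = trans (sum-cong-≗ (λ x → split (P? x) (Q? x)))
                         (∑-distrib-+ (indicator ∘ (P? ∩? Q?)) (indicator ∘ (P? ∩? ∁? Q?)))
    where
    split : (a? : Dec A) (b? : Dec B) → indicator a? ≡ indicator (a? ×-dec b?) + indicator (a? ×-dec ¬? b?)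
    split (yes _) (yes _) = refl
    split (yes _) (no _)  = refl
    split (no _)  _       = refl

  count-union : {Q : Pred (Fin m) ℓ′} (Q? : Decidable Q) →
                count (P? ∪? Q?) + count (P? ∩? Q?) ≡ count P? + count Q?
  count-union Q? = begin
    count (P? ∪? Q?) + count (P? ∩? Q?)
      ≡⟨ ∑-distrib-+ (indicator ∘ (P? ∪? Q?)) (indicator ∘ (P? ∩? Q?)) ⟨
    ∑[ x < m ] (indicator ((P? ∪? Q?) x) + indicator ((P? ∩? Q?) x))
      ≡⟨ sum-cong-≗ (λ x → inclusion-exclusion (P? x) (Q? x)) ⟩
    ∑[ x < m ] (indicator (P? x) + indicator (Q? x))
      ≡⟨ ∑-distrib-+ (indicator ∘ P?) (indicator ∘ Q?) ⟩
    count P? + count Q?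
      ∎
    where
    open ≡-Reasoning
    inclusion-exclusion : (a? : Dec A) (b? : Dec B) →
      indicator (a? ⊎-dec b?) + indicator (a? ×-dec b?) ≡ indicator a? + indicator b?
    inclusion-exclusion (yes _) (yes _) = refl
    inclusion-exclusion (yes _) (no _)  = refl
    inclusion-exclusion (no _)  (yes _) = refl
    inclusion-exclusion (no _)  (no _)  = refl

P⇒0<count : {P : Pred (Fin m) ℓ} (P? : Decidable P) → ∀ {x} → P x → 0 < count P?
P⇒0<count P? {zero}  px rewrite dec-true (P? zero) px = s≤s z≤n
P⇒0<count P? {suc x} px = ≤-trans (P⇒0<count (P? ∘ suc) px) (m≤n+m _ _)

0<count⇒∃ : {P : Pred (Fin m) ℓ} (P? : Decidable P) → 0 < count P? → ∃ P
0<count⇒∃ P? pos with any? P?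
... | yes found = found
... | no ∄P     = contradiction (count-∅ P? (λ x px → ∄P (x , px))) (>⇒≢ pos)

count-U : count (U? {A = Fin m}) ≡ m
count-U {zero}  = refl
count-U {suc m} = cong suc (count-U {m})

module _ {P : Pred (Fin m) ℓ} {Q : Pred (Fin m) ℓ′} (P? : Decidable P) (Q? : Decidable Q) (P⊆Q : P ⊆ Q) where

  private
    count-difference : count Q? ≡ count P? + count (Q? ∩? ∁? P?)
    count-difference = trans (count-split Q? P?)
      (cong (_+ count (Q? ∩? ∁? P?)) (count-cong (Q? ∩? P?) P? (proj₂ , λ p → P⊆Q p , p)))

  count-mono : count P? ≤ count Q?
  count-mono = subst (count P? ≤_) (sym count-difference) (m≤m+n _ _)

  count-mono-< : ∀ {x} → Q x → ¬ P x → count P? < count Q?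
  count-mono-< qx ¬px = subst (count P? <_) (sym count-difference)
    (m<m+n (count P?) (P⇒0<count (Q? ∩? ∁? P?) (qx , ¬px)))

  count-≥⇒⊇ : count Q? ≤ count P? → Q ⊆ P
  count-≥⇒⊇ Q≤P {x} qx = decidable-stable (P? x) λ ¬px →
    >⇒≢ (P⇒0<count (Q? ∩? ∁? P?) (qx , ¬px)) (n≤0⇒n≡0 difference≤0)
    where
    difference≤0 : count (Q? ∩? ∁? P?) ≤ 0
    difference≤0 = +-cancelˡ-≤ (count P?) _ _
      (subst₂ _≤_ count-difference (sym (+-identityʳ (count P?))) Q≤P)

count-all : {P : Pred (Fin m) ℓ} (P? : Decidable P) → m ≤ count P? → ∀ x → P x
count-all P? m≤P x = count-≥⇒⊇ P? U? _ (subst (_≤ count P?) (sym count-U) m≤P) _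

count-singleton : (a : Fin m) → count (a ≟_) ≡ 1
count-singleton {suc m} zero    = cong suc (count-∅ (λ (i : Fin m) → zero ≟ suc i) λ _ ())
count-singleton {suc m} (suc a) = count-singleton a

Image : (Fin k → Fin m) → Pred (Fin m) 0ℓ
Image f y = ∃ λ i → f i ≡ y

image? : (f : Fin k → Fin m) → Decidable (Image f)
image? f y = any? (λ i → f i ≟ y)

private
  count-image-suc : (f : Fin (suc k) → Fin m) →
    count (image? f) + count ((f zero ≟_) ∩? image? (f ∘ suc)) ≡ suc (count (image? (f ∘ suc)))
  count-image-suc f = trans (count-union (f zero ≟_) (image? (f ∘ suc)))
                            (cong (_+ count (image? (f ∘ suc))) (count-singleton (f zero)))

count-image-≤ : (f : Fin k → Fin m) → count (image? f) ≤ k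
count-image-≤ {zero}  f = ≤-reflexive (count-∅ (image? f) λ _ ())
count-image-≤ {suc k} f = begin
  count (image? f)                                            ≤⟨ m≤m+n _ _ ⟩
  count (image? f) + count ((f zero ≟_) ∩? image? (f ∘ suc))  ≡⟨ count-image-suc f ⟩
  suc (count (image? (f ∘ suc)))                              ≤⟨ s≤s (count-image-≤ (f ∘ suc)) ⟩
  suc k                                                       ∎
  where open ≤-Reasoning

count-image-injective : (f : Fin k → Fin m) → Injective _≡_ _≡_ f → count (image? f) ≡ k
count-image-injective {zero}  f _     = count-∅ (image? f) λ _ ()
count-image-injective {suc k} f f-inj = begin
  count (image? f)                                            ≡⟨ +-identityʳ _ ⟨
  count (image? f) + 0                                        ≡⟨ cong (count (image? f) +_) disjoint ⟨
  count (image? f) + count ((f zero ≟_) ∩? image? (f ∘ suc))  ≡⟨ count-image-suc f ⟩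
  suc (count (image? (f ∘ suc)))                              ≡⟨ cong suc (count-image-injective (f ∘ suc) (suc-injective ∘ f-inj)) ⟩
  suc k                                                       ∎
  where
  open ≡-Reasoning
  disjoint : count ((f zero ≟_) ∩? image? (f ∘ suc)) ≡ 0
  disjoint = count-∅ ((f zero ≟_) ∩? image? (f ∘ suc)) λ { _ (refl , i , fi≡f0) → Finₚ.0≢1+n (f-inj (sym fi≡f0)) }

injective⇒surjective : {f : Fin m → Fin m} → Injective _≡_ _≡_ f → ∀ y → Image f y
injective⇒surjective {f = f} f-inj = count-all (image? f) (≤-reflexive (sym (count-image-injective f f-inj)))

count-fibres : {P : Pred (Fin m) ℓ} (P? : Decidable P) (f : Fin m → Fin k) →
               count P? ≡ ∑[ j < k ] count (λ x → P? x ×-dec f x ≟ j)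
count-fibres {m = m} {k = k} P? f =
  trans (sum-cong-≗ (λ x → sym (fibre-sum (P? x) (f x))))
        (∑-comm (λ x j → indicator (P? x ×-dec f x ≟ j)))
  where
  fibre-sum : (a? : Dec A) (y : Fin k) → ∑[ j < k ] indicator (a? ×-dec y ≟ j) ≡ indicator a?
  fibre-sum (yes _) y = count-singleton y
  fibre-sum (no _)  y = sum-replicate-zero k

involution-fixedPoint : {S : Pred (Fin m) ℓ} (S? : Decidable S) (σ : Fin m → Fin m) →
  (∀ x → σ (σ x) ≡ x) → (∀ {x} → S x → S (σ x)) → ¬ 2 ∣ count S? → ∃ λ x → S x × σ x ≡ x
-- Without a fixed point in S, σ maps {x ∈ S ∣ ¬ x < σ x} bijectively onto {x ∈ S ∣ x < σ x}.
involution-fixedPoint {m = m} {S = S} S? σ σσ S-σ odd with any? (λ x → S? x ×-dec σ x ≟ x)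
... | yes fixed   = fixed
... | no ∄fixed = contradiction (divides c even) odd
  where
  below? : Decidable (λ x → x Fin.< σ x)
  below? x = x Finₚ.<? σ x
  above⇒σ-below : ∀ {x} → S x × ¬ x Fin.< σ x → S (σ x) × σ x Fin.< σ (σ x)
  above⇒σ-below {x} (sx , x≮σx) = S-σ sx , subst (σ x Fin.<_) (sym (σσ x))
    (Finₚ.≤∧≢⇒< (≮⇒≥ x≮σx) (λ σx≡x → ∄fixed (x , sx , σx≡x)))
  σ-below⇒above : ∀ {x} → S (σ x) × σ x Fin.< σ (σ x) → S x × ¬ x Fin.< σ x
  σ-below⇒above {x} (sσx , σx<x) = subst S (σσ x) (S-σ sσx) ,
    λ x<σx → Finₚ.<-asym x<σx (subst (σ x Fin.<_) (σσ x) σx<x)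
  σ-permutation : Permutation m m
  σ-permutation = permutation σ σ σσ σσ
  c = count (S? ∩? below?)
  even : count S? ≡ c * 2
  even = begin
    count S?                                       ≡⟨ count-split S? below? ⟩
    c + count (S? ∩? ∁? below?)                    ≡⟨ cong (c +_) (count-cong (S? ∩? ∁? below?) ((S? ∩? below?) ∘ σ)
                                                                               (above⇒σ-below , σ-below⇒above)) ⟩
    c + count ((S? ∩? below?) ∘ σ)                 ≡⟨ cong (c +_) (count-permute (S? ∩? below?) σ-permutation) ⟩
    c + c                                          ≡⟨ cong (c +_) (+-identityʳ c) ⟨
    2 * c                                          ≡⟨ *-comm 2 c ⟩
    c * 2                                          ∎
    where open ≡-Reasoning

toSubset : {P : Pred (Fin m) ℓ} → Decidable P → Subset m
toSubset P? = tabulate (does ∘ P?)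

∣toSubset∣ : {P : Pred (Fin m) ℓ} (P? : Decidable P) → ∣ toSubset P? ∣ ≡ count P?
∣toSubset∣ {m = zero}  P? = refl
∣toSubset∣ {m = suc m} P? with P? zero
... | yes _ = cong suc (∣toSubset∣ (P? ∘ suc))
... | no _  = ∣toSubset∣ (P? ∘ suc)

∈toSubset⁺ : {P : Pred (Fin m) ℓ} (P? : Decidable P) → ∀ {x} → P x → x ∈ toSubset P?
∈toSubset⁺ P? {x} px = lookup⇒[]= x (toSubset P?) (trans (lookup∘tabulate (does ∘ P?) x) (dec-true (P? x) px))

∈toSubset⁻ : {P : Pred (Fin m) ℓ} (P? : Decidable P) → ∀ {x} → x ∈ toSubset P? → P x
∈toSubset⁻ P? {x} x∈ with P? x | trans (sym (lookup∘tabulate (does ∘ P?) x)) ([]=⇒lookup x∈)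
... | yes px | _ = px

-- Canonical representatives of equivalence classes

search : {P : Pred (Fin m) ℓ} → Decidable P → Maybe (Fin m)
search {m = zero}  P? = nothing
search {m = suc m} P? = if does (P? zero) then just zero else Maybe.map suc (search (P? ∘ suc))

search-cong : {P : Pred (Fin m) ℓ} {Q : Pred (Fin m) ℓ′} (P? : Decidable P) (Q? : Decidable Q) →
              P ≐ Q → search P? ≡ search Q?
search-cong {m = zero}  P? Q? _               = refl
search-cong {m = suc m} P? Q? (P⊆Q , Q⊆P) =
  cong₂ (λ b r → if b then just zero else Maybe.map suc r)
        (does-⇔ (mk⇔ P⊆Q Q⊆P) (P? zero) (Q? zero))
        (search-cong (P? ∘ suc) (Q? ∘ suc) (P⊆Q , Q⊆P))

search-sound : {P : Pred (Fin m) ℓ} (P? : Decidable P) → ∀ {y} → search P? ≡ just y → P y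
search-sound {m = suc m} P? eq with P? zero
... | yes p₀ with refl ← eq = p₀
... | no _ with search (P? ∘ suc) in eq′
...   | just y with refl ← eq = search-sound (P? ∘ suc) eq′

search-complete : {P : Pred (Fin m) ℓ} (P? : Decidable P) → ∀ {x} → P x → ∃ λ y → search P? ≡ just y
search-complete {m = suc m} P? {x} px with P? zero | x
... | yes _   | _     = zero , refl
... | no ¬p₀ | zero  = contradiction px ¬p₀
... | no _    | suc x = Product.map suc (cong (Maybe.map suc)) (search-complete (P? ∘ suc) px)

-- _∼_ is a partial equivalence relation, whose classes partition {x ∣ x ∼ x}.
module Classes {_∼_ : Rel (Fin m) ℓ} (_∼?_ : B.Decidable _∼_)
               (∼-sym : Symmetric _∼_) (∼-trans : Transitive _∼_) where

  private
    ∼-reflˡ : ∀ {x y} → x ∼ y → x ∼ x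
    ∼-reflˡ x∼y = ∼-trans x∼y (∼-sym x∼y)

    ∼-reflʳ : ∀ {x y} → x ∼ y → y ∼ y
    ∼-reflʳ x∼y = ∼-trans (∼-sym x∼y) x∼y

  rep : Fin m → Fin m
  rep x = fromMaybe x (search (x ∼?_))

  rep-∼ : ∀ {x} → x ∼ x → x ∼ rep x
  rep-∼ {x} x∼x with y , eq ← search-complete (x ∼?_) x∼x rewrite eq = search-sound (x ∼?_) eq

  rep-cong : ∀ {x y} → x ∼ y → rep x ≡ rep y
  rep-cong {x} {y} x∼y with z , eq ← search-complete (x ∼?_) (∼-reflˡ x∼y) = begin
    fromMaybe x (search (x ∼?_))  ≡⟨ cong (fromMaybe x) eq ⟩
    z                             ≡⟨ cong (fromMaybe y) (trans (sym same-class) eq) ⟨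
    fromMaybe y (search (y ∼?_))  ∎
    where
    open ≡-Reasoning
    same-class : search (x ∼?_) ≡ search (y ∼?_)
    same-class = search-cong (x ∼?_) (y ∼?_) (∼-trans (∼-sym x∼y) , ∼-trans x∼y)

  rep-injective : ∀ {x y} → x ∼ x → y ∼ y → rep x ≡ rep y → x ∼ y
  rep-injective {x} x∼x y∼y eq = ∼-trans (subst (x ∼_) eq (rep-∼ x∼x)) (∼-sym (rep-∼ y∼y))

  IsRep : Pred (Fin m) ℓ
  IsRep y = y ∼ y × rep y ≡ y

  IsRep? : Decidable IsRep
  IsRep? y = (y ∼? y) ×-dec (rep y ≟ y)

  rep-IsRep : ∀ {x} → x ∼ x → IsRep (rep x)
  rep-IsRep x∼x = ∼-reflʳ (rep-∼ x∼x) , rep-cong (∼-sym (rep-∼ x∼x))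

  count-classes : count (λ x → x ∼? x) ≡ ∑[ y < m ] (indicator (IsRep? y) * count (y ∼?_))
  count-classes = trans (count-fibres (λ x → x ∼? x) rep) (sum-cong-≗ λ y → fibre y (IsRep? y))
    where
    fibre : ∀ y (rep? : Dec (IsRep y)) →
            count (λ x → (x ∼? x) ×-dec (rep x ≟ y)) ≡ indicator rep? * count (y ∼?_)
    fibre y (yes (_ , rep-y≡y)) =
      trans (count-cong (λ x → (x ∼? x) ×-dec (rep x ≟ y)) (y ∼?_) (to , from)) (sym (+-identityʳ _))
      where
      to : ∀ {x} → x ∼ x × rep x ≡ y → y ∼ x
      to (x∼x , refl) = ∼-sym (rep-∼ x∼x)
      from : ∀ {x} → y ∼ x → x ∼ x × rep x ≡ y
      from y∼x = ∼-reflʳ y∼x , trans (rep-cong (∼-sym y∼x)) rep-y≡y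
    fibre y (no ¬rep) =
      count-∅ (λ x → (x ∼? x) ×-dec (rep x ≟ y)) λ { x (x∼x , refl) → ¬rep (rep-IsRep x∼x) }

  count-classes-uniform : ∀ s → (∀ {y} → IsRep y → count (y ∼?_) ≡ s) → count (λ x → x ∼? x) ≡ count IsRep? * s
  count-classes-uniform s uniform =
    trans count-classes (trans (sum-cong-≗ λ y → term y (IsRep? y)) (sym (*-distribʳ-sum s (indicator ∘ IsRep?))))
    where
    term : ∀ y (rep? : Dec (IsRep y)) → indicator rep? * count (y ∼?_) ≡ indicator rep? * s
    term y (yes rep-y) = cong (1 *_) (uniform rep-y)
    term y (no _)      = refl

  module _ (∼-refl : ∀ {x} → x ∼ x) where

    -- Sending each representative r to rep (f r) and fixing all other points is injective.
    private
      lift : (f : Fin m → Fin m) → ∀ x → Dec (IsRep x) → Fin m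
      lift f x (yes _) = rep (f x)
      lift f x (no _)  = x

      lift-injective : ∀ f → (∀ {x y} → f x ∼ f y → x ∼ y) →
                       ∀ {x x′} (rep? : Dec (IsRep x)) (rep?′ : Dec (IsRep x′)) →
                       lift f x rep? ≡ lift f x′ rep?′ → x ≡ x′
      lift-injective f f-inj (yes (_ , rep-x≡x)) (yes (_ , rep-x′≡x′)) eq =
        trans (sym rep-x≡x) (trans (rep-cong (f-inj (rep-injective ∼-refl ∼-refl eq))) rep-x′≡x′)
      lift-injective f f-inj (yes _)      (no ¬rep-x′) eq = contradiction (subst IsRep eq (rep-IsRep ∼-refl)) ¬rep-x′
      lift-injective f f-inj (no ¬rep-x) (yes _)       eq = contradiction (subst IsRep (sym eq) (rep-IsRep ∼-refl)) ¬rep-x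
      lift-injective f f-inj (no _)       (no _)       eq = eq

    injective-mod⇒surjective-mod : (f : Fin m → Fin m) → (∀ {x y} → f x ∼ f y → x ∼ y) → ∀ y → ∃ λ x → f x ∼ y
    injective-mod⇒surjective-mod f f-inj y
      with x , eq ← injective⇒surjective {f = λ x → lift f x (IsRep? x)}
                                          (λ {x} {x′} → lift-injective f f-inj (IsRep? x) (IsRep? x′)) (rep y)
      with IsRep? x
    ... | yes _     = x , rep-injective ∼-refl ∼-refl eq
    ... | no ¬rep-x = contradiction (subst IsRep (sym eq) (rep-IsRep ∼-refl)) ¬rep-x

module PrimePowers {p : ℕ} (p-prime : Prime p) where

  1<p : 1 < p
  1<p = nonTrivial⇒n>1 p {{prime⇒nonTrivial p-prime}}

  p∤1 : ¬ p ∣ 1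
  p∤1 p∣1 = ¬prime[1] (subst Prime (∣1⇒≡1 p∣1) p-prime)

  ∣p^k⇒≡1⊎p∣ : ∀ k {d} → d ∣ p ℕ.^ k → d ≡ 1 ⊎ p ∣ d
  ∣p^k⇒≡1⊎p∣ zero    d∣1 = inj₁ (∣1⇒≡1 d∣1)
  ∣p^k⇒≡1⊎p∣ (suc k) {d} d∣p^1+k with p ∣? d
  ... | yes p∣d = inj₂ p∣d
  ... | no  p∤d = ∣p^k⇒≡1⊎p∣ k (coprime-divisor coprime d∣p^1+k)
    where
    coprime : Coprime d p
    coprime (i∣d , i∣p) with prime⇒irreducible p-prime i∣p
    ... | inj₁ i≡1 = i≡1
    ... | inj₂ refl = contradiction i∣d p∤d

  ∣p^k⇒odd : p % 2 ≡ 1 → ∀ k {d} → d ∣ p ℕ.^ k → ¬ 2 ∣ d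
  ∣p^k⇒odd p-odd k d∣p^k 2∣d with ∣p^k⇒≡1⊎p∣ k (∣-trans 2∣d d∣p^k)
  ... | inj₂ p∣2 with refl ← ≤-antisym (∣⇒≤ p∣2) 1<p = contradiction p-odd λ ()

crossing : {P : Pred ℕ ℓ} → Decidable P → ∀ k → ¬ P 0 → P k → ∃ λ t → ¬ P t × P (suc t)
crossing P? zero    ¬P₀ P₀   = contradiction P₀ ¬P₀
crossing P? (suc k) ¬P₀ Pₖ₊₁ with P? k
... | yes Pₖ = crossing P? k ¬P₀ Pₖ
... | no ¬Pₖ = k , ¬Pₖ , Pₖ₊₁

-- Subgroups and powers are stated for the raw operations, so that a subgroup or a power in a
-- quotient group G/H on the carrier of G is literally one in G.
record IsSubgroupPred {a ℓ} {A : Set a} (_∙_ : Op₂ A) (ε : A) (_⁻¹ : Op₁ A) (S : Pred A ℓ) : Set (a ⊔ ℓ) where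
  field
    ε∈       : S ε
    ∙-closed : ∀ {x y} → S x → S y → S (x ∙ y)
    ⁻¹-closed : ∀ {x} → S x → S (x ⁻¹)

power : ∀ {a} {A : Set a} → Op₂ A → A → A → ℕ → A
power _∙_ ε x zero    = ε
power _∙_ ε x (suc k) = x ∙ power _∙_ ε x k

module GroupPowers {c ℓ} (H : Group c ℓ) where
  open Group H renaming (refl to ≈-refl; sym to ≈-sym; trans to ≈-trans)
  open import Algebra.Properties.Group H using (inverseʳ-unique)
  open import Relation.Binary.Reasoning.Setoid setoid

  infixr 8 _^_
  _^_ : Carrier → ℕ → Carrier
  _^_ = power _∙_ ε

  ^-+ : ∀ x a b → x ^ (a + b) ≈ x ^ a ∙ x ^ b
  ^-+ x zero    b = ≈-sym (identityˡ _)
  ^-+ x (suc a) b = ≈-trans (∙-congˡ (^-+ x a b)) (≈-sym (assoc _ _ _))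

  ε^ : ∀ a → ε ^ a ≈ ε
  ε^ zero    = ≈-refl
  ε^ (suc a) = ≈-trans (identityˡ _) (ε^ a)

  ^-congˡ : ∀ {x y} → x ≈ y → ∀ a → x ^ a ≈ y ^ a
  ^-congˡ x≈y zero    = ≈-refl
  ^-congˡ x≈y (suc a) = ∙-cong x≈y (^-congˡ x≈y a)

  ^-* : ∀ x a b → x ^ (a * b) ≈ (x ^ b) ^ a
  ^-* x zero    b = ≈-refl
  ^-* x (suc a) b = ≈-trans (^-+ x b (a * b)) (∙-congˡ (^-* x a b))

  module Period {x : Carrier} {d : ℕ} .{{_ : NonZero d}} (xᵈ≈ε : x ^ d ≈ ε) where

    ^-multiple : ∀ q → x ^ (q * d) ≈ ε
    ^-multiple q = ≈-trans (^-* x q d) (≈-trans (^-congˡ xᵈ≈ε q) (ε^ q))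

    ^-mod : ∀ a → x ^ a ≈ x ^ (a % d)
    ^-mod a = begin
      x ^ a                            ≡⟨ cong (x ^_) (m≡m%n+[m/n]*n a d) ⟩
      x ^ (a % d + a / d * d)          ≈⟨ ^-+ x (a % d) _ ⟩
      x ^ (a % d) ∙ x ^ (a / d * d)    ≈⟨ ∙-congˡ (^-multiple (a / d)) ⟩
      x ^ (a % d) ∙ ε                  ≈⟨ identityʳ _ ⟩
      x ^ (a % d)                      ∎

    ^-inverse : ∀ a → (x ^ a) ⁻¹ ≈ x ^ (ℕ.pred d * a)
    ^-inverse a = ≈-sym (inverseʳ-unique (x ^ a) (x ^ (ℕ.pred d * a)) (begin
      x ^ a ∙ x ^ (ℕ.pred d * a)       ≈⟨ ^-+ x a (ℕ.pred d * a) ⟨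
      x ^ (suc (ℕ.pred d) * a)         ≡⟨ cong (λ e → x ^ (e * a)) (suc-pred d) ⟩
      x ^ (d * a)                      ≡⟨ cong (x ^_) (*-comm d a) ⟩
      x ^ (a * d)                      ≈⟨ ^-multiple a ⟩
      ε                                ∎))

    Cyclic : Pred Carrier ℓ
    Cyclic y = ∃ λ (i : Fin d) → x ^ toℕ i ≈ y

    ^∈Cyclic : ∀ a → Cyclic (x ^ a)
    ^∈Cyclic a = fromℕ< (m%n<n a d) , ≈-trans (reflexive (cong (x ^_) (toℕ-fromℕ< (m%n<n a d)))) (≈-sym (^-mod a))

    Cyclic-resp : ∀ {y z} → Cyclic y → y ≈ z → Cyclic z
    Cyclic-resp (i , xⁱ≈y) y≈z = i , ≈-trans xⁱ≈y y≈z

    cyclic-isSubgroup : IsSubgroupPred _∙_ ε _⁻¹ Cyclic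
    cyclic-isSubgroup = record
      { ε∈       = ^∈Cyclic 0
      ; ∙-closed = λ { (i , xⁱ≈y) (j , xʲ≈z) →
          Cyclic-resp (^∈Cyclic (toℕ i + toℕ j)) (≈-trans (^-+ x (toℕ i) (toℕ j)) (∙-cong xⁱ≈y xʲ≈z)) }
      ; ⁻¹-closed = λ { (i , xⁱ≈y) →
          Cyclic-resp (^∈Cyclic (ℕ.pred d * toℕ i)) (≈-trans (≈-sym (^-inverse (toℕ i))) (⁻¹-cong xⁱ≈y)) }
      }

module FiniteGroupTheory (G : FiniteGroup) where
  open FiniteGroup G using (n; isGroup)

  group : Group 0ℓ 0ℓ
  group = record { isGroup = isGroup }

  open Group group public using (_∙_; ε; _⁻¹)
  open Group group using (assoc; identityˡ; identityʳ; inverseˡ; inverseʳ; monoid)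
  open import Algebra.Solver.Monoid monoid using (solve; _⊜_; _⊕_)

  open import Algebra.Properties.Group group
    using ( ε⁻¹≈ε; ⁻¹-involutive; ⁻¹-anti-homo-∙; identityʳ-unique
          ; \\-leftDividesˡ; \\-leftDividesʳ; //-rightDividesˡ; //-rightDividesʳ)

  Subgroup : Pred (Fin n) 0ℓ → Set
  Subgroup = IsSubgroupPred _∙_ ε _⁻¹

  Normal : Pred (Fin n) 0ℓ → Set
  Normal M = ∀ x a → M a → M (x ⁻¹ ∙ a ∙ x)

  translationˡ translationʳ : Fin n → Permutation n n
  translationˡ a = permutation (a ∙_) (a ⁻¹ ∙_) (\\-leftDividesˡ a) (\\-leftDividesʳ a)
  translationʳ a = permutation (_∙ a) (_∙ a ⁻¹) (//-rightDividesˡ a) (//-rightDividesʳ a)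

  module Cosets {K : Pred (Fin n) 0ℓ} (K? : Decidable K) (K-sub : Subgroup K) where
    open IsSubgroupPred K-sub

    infix 4 _∼_ _∼?_
    _∼_ : Rel (Fin n) 0ℓ
    x ∼ y = K (x ⁻¹ ∙ y)

    _∼?_ : B.Decidable _∼_
    x ∼? y = K? (x ⁻¹ ∙ y)

    ∼-refl : ∀ {x} → x ∼ x
    ∼-refl {x} = subst K (sym (inverseˡ x)) ε∈

    ∼-sym : Symmetric _∼_
    ∼-sym {x} {y} x∼y = subst K (trans (⁻¹-anti-homo-∙ (x ⁻¹) y) (cong (y ⁻¹ ∙_) (⁻¹-involutive x)))
                              (⁻¹-closed x∼y)

    ∼-trans : Transitive _∼_
    ∼-trans {x} {y} {z} x∼y y∼z = subst K (trans (assoc (x ⁻¹) y (y ⁻¹ ∙ z)) (cong (x ⁻¹ ∙_) (\\-leftDividesˡ y z)))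
                                        (∙-closed x∼y y∼z)

    ∼-∙ˡ : ∀ a {x y} → x ∼ y → a ∙ x ∼ a ∙ y
    ∼-∙ˡ a {x} {y} = subst K (sym (begin
      (a ∙ x) ⁻¹ ∙ (a ∙ y)         ≡⟨ cong (_∙ (a ∙ y)) (⁻¹-anti-homo-∙ a x) ⟩
      x ⁻¹ ∙ a ⁻¹ ∙ (a ∙ y)        ≡⟨ assoc (x ⁻¹) (a ⁻¹) (a ∙ y) ⟩
      x ⁻¹ ∙ (a ⁻¹ ∙ (a ∙ y))      ≡⟨ cong (x ⁻¹ ∙_) (\\-leftDividesʳ a y) ⟩
      x ⁻¹ ∙ y                     ∎))
      where open ≡-Reasoning

    ≡⇒∼ : ∀ {x y} → x ≡ y → x ∼ y
    ≡⇒∼ refl = ∼-refl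

    ∈⇒ε∼ : ∀ {x} → K x → ε ∼ x
    ∈⇒ε∼ {x} = subst K (sym (trans (cong (_∙ x) ε⁻¹≈ε) (identityˡ x)))

    ε∼⇒∈ : ∀ {x} → ε ∼ x → K x
    ε∼⇒∈ {x} = subst K (trans (cong (_∙ x) ε⁻¹≈ε) (identityˡ x))

    open Classes _∼?_ ∼-sym ∼-trans public

    index : ℕ
    index = count IsRep?

    coset-size : ∀ x → count (x ∼?_) ≡ count K?
    coset-size x = count-permute K? (translationˡ (x ⁻¹))

    lagrange : n ≡ index * count K?
    lagrange = begin
      n                          ≡⟨ count-U ⟨
      count (U? {A = Fin n})     ≡⟨ count-cong U? (λ x → x ∼? x) ((λ _ → ∼-refl) , _) ⟩
      count (λ x → x ∼? x)       ≡⟨ count-classes-uniform (count K?) (λ {y} _ → coset-size y) ⟩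
      index * count K?           ∎
      where open ≡-Reasoning

    order∣n : count K? ∣ n
    order∣n = divides index lagrange

    index∣n : index ∣ n
    index∣n = divides (count K?) (trans lagrange (*-comm index (count K?)))

    index≡1⇒total : index ≡ 1 → ∀ x → K x
    index≡1⇒total index≡1 = count-all K? (≤-reflexive (trans lagrange (trans (cong (_* count K?) index≡1) (+-identityʳ _))))

  module Action {A : Pred (Fin n) 0ℓ} (A? : Decidable A) (A-sub : Subgroup A)
                {m} {X : Pred (Fin m) 0ℓ} (X? : Decidable X) (act : Fin n → Fin m → Fin m)
                (act-ε : ∀ {x} → X x → act ε x ≡ x)
                (act-∙ : ∀ {a b x} → A a → A b → X x → act (a ∙ b) x ≡ act a (act b x))
                (act-X : ∀ {a x} → A a → X x → X (act a x)) where
    open IsSubgroupPred A-sub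

    infix 4 _∼_ _∼?_
    _∼_ : Rel (Fin m) 0ℓ
    x ∼ y = X x × ∃ λ a → A a × act a x ≡ y

    _∼?_ : B.Decidable _∼_
    x ∼? y = X? x ×-dec any? (λ a → A? a ×-dec act a x ≟ y)

    act-⁻¹ : ∀ {a x} → A a → X x → act (a ⁻¹) (act a x) ≡ x
    act-⁻¹ {a} {x} Aa Xx =
      trans (sym (act-∙ (⁻¹-closed Aa) Aa Xx)) (trans (cong (λ b → act b x) (inverseˡ a)) (act-ε Xx))

    ∼-sym : Symmetric _∼_
    ∼-sym (Xx , a , Aa , refl) = act-X Aa Xx , a ⁻¹ , ⁻¹-closed Aa , act-⁻¹ Aa Xx

    ∼-trans : Transitive _∼_
    ∼-trans (Xx , a , Aa , refl) (_ , b , Ab , refl) = Xx , b ∙ a , ∙-closed Ab Aa , act-∙ Ab Aa Xx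

    open Classes _∼?_ ∼-sym ∼-trans public

    Stabiliser : Fin m → Pred (Fin n) 0ℓ
    Stabiliser y a = A a × act a y ≡ y

    stabiliser? : ∀ y → Decidable (Stabiliser y)
    stabiliser? y a = A? a ×-dec act a y ≟ y

    orbit-stabiliser : ∀ {y} → X y → count A? ≡ count (y ∼?_) * count (stabiliser? y)
    orbit-stabiliser {y} Xy = begin
      count A?
        ≡⟨ count-fibres A? (λ a → act a y) ⟩
      ∑[ z < m ] count (λ a → A? a ×-dec act a y ≟ z)
        ≡⟨ sum-cong-≗ (λ z → fibre z (y ∼? z)) ⟩
      ∑[ z < m ] (indicator (y ∼? z) * count (stabiliser? y))
        ≡⟨ *-distribʳ-sum (count (stabiliser? y)) (indicator ∘ (y ∼?_)) ⟨
      count (y ∼?_) * count (stabiliser? y)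
        ∎
      where
      open ≡-Reasoning
      fibre : ∀ z (y∼?z : Dec (y ∼ z)) →
              count (λ a → A? a ×-dec act a y ≟ z) ≡ indicator y∼?z * count (stabiliser? y)
      fibre z (no ¬y∼z) = count-∅ (λ a → A? a ×-dec act a y ≟ z) λ a (Aa , ay≡z) → ¬y∼z (Xy , a , Aa , ay≡z)
      fibre z (yes (_ , b , Ab , refl)) = begin
        count (λ a → A? a ×-dec act a y ≟ act b y)
          ≡⟨ count-cong (λ a → A? a ×-dec act a y ≟ act b y) (stabiliser? y ∘ (b ⁻¹ ∙_)) (to , from) ⟩
        count (stabiliser? y ∘ (b ⁻¹ ∙_))
          ≡⟨ count-permute (stabiliser? y) (translationˡ (b ⁻¹)) ⟩
        count (stabiliser? y)
          ≡⟨ +-identityʳ _ ⟨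
        count (stabiliser? y) + 0
          ∎
        where
        to : ∀ {a} → A a × act a y ≡ act b y → Stabiliser y (b ⁻¹ ∙ a)
        to {a} (Aa , ay≡by) = ∙-closed (⁻¹-closed Ab) Aa ,
          trans (act-∙ (⁻¹-closed Ab) Aa Xy) (trans (cong (act (b ⁻¹)) ay≡by) (act-⁻¹ Ab Xy))
        from : ∀ {a} → Stabiliser y (b ⁻¹ ∙ a) → A a × act a y ≡ act b y
        from {a} (Ab⁻¹a , b⁻¹ay≡y) = subst A b[b⁻¹a]≡a (∙-closed Ab Ab⁻¹a) ,
          trans (cong (λ c → act c y) (sym b[b⁻¹a]≡a)) (trans (act-∙ Ab Ab⁻¹a Xy) (cong (act b) b⁻¹ay≡y))
          where
          b[b⁻¹a]≡a : b ∙ (b ⁻¹ ∙ a) ≡ a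
          b[b⁻¹a]≡a = \\-leftDividesˡ b a

    Fixed : Pred (Fin m) 0ℓ
    Fixed y = X y × (∀ a → A a → act a y ≡ y)

    fixed? : Decidable Fixed
    fixed? y = X? y ×-dec all? (λ a → A? a →-dec act a y ≟ y)

    fixed⇒orbit≐singleton : ∀ {y} → Fixed y → (y ∼_) ≐ (y ≡_)
    fixed⇒orbit≐singleton (Xy , fixed) = (λ { (_ , a , Aa , refl) → sym (fixed a Aa) })
                                        , (λ { refl → Xy , ε , ε∈ , act-ε Xy })

    fixed⇒IsRep : ∀ {y} → Fixed y → IsRep y
    fixed⇒IsRep fixedy = let orbit⊆ , ⊆orbit = fixed⇒orbit≐singleton fixedy
                         in ⊆orbit refl , sym (orbit⊆ (rep-∼ (⊆orbit refl)))

    orbit-size-1⇒fixed : ∀ {y} → X y → count (y ∼?_) ≡ 1 → Fixed y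
    orbit-size-1⇒fixed {y} Xy size≡1 = Xy , λ a Aa → sym (orbit⊆singleton (Xy , a , Aa , refl))
      where
      orbit⊆singleton : (y ∼_) ⊆ (y ≡_)
      orbit⊆singleton = count-≥⇒⊇ (y ≟_) (y ∼?_) (λ { refl → Xy , ε , ε∈ , act-ε Xy })
                                  (≤-reflexive (trans size≡1 (sym (count-singleton y))))

    module _ {p : ℕ} (p-prime : Prime p) (k : ℕ) (A∣p^k : count A? ∣ p ℕ.^ k) where
      open PrimePowers p-prime

      fixedPoints-mod-p : ∃ λ q → count X? ≡ count fixed? + q * p
      fixedPoints-mod-p = ∑[ y < m ] q y , (begin
        count X?
          ≡⟨ count-cong X? (λ x → x ∼? x) (X⇒∼ , proj₁) ⟩
        count (λ x → x ∼? x)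
          ≡⟨ count-classes ⟩
        ∑[ y < m ] (indicator (IsRep? y) * count (y ∼?_))
          ≡⟨ sum-cong-≗ (λ y → proj₂ (term y (IsRep? y) (fixed? y))) ⟩
        ∑[ y < m ] (indicator (fixed? y) + q y * p)
          ≡⟨ ∑-distrib-+ (indicator ∘ fixed?) (λ y → q y * p) ⟩
        count fixed? + ∑[ y < m ] (q y * p)
          ≡⟨ cong (count fixed? +_) (*-distribʳ-sum p q) ⟨
        count fixed? + (∑[ y < m ] q y) * p
          ∎)
        where
        open ≡-Reasoning
        X⇒∼ : ∀ {x} → X x → x ∼ x
        X⇒∼ Xx = Xx , ε , ε∈ , act-ε Xx
        orbit-size∣p^k : ∀ {y} → X y → count (y ∼?_) ∣ p ℕ.^ k
        orbit-size∣p^k {y} Xy = ∣-trans (divides (count (stabiliser? y))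
          (trans (orbit-stabiliser Xy) (*-comm (count (y ∼?_)) _))) A∣p^k
        term : ∀ y (rep? : Dec (IsRep y)) (fixed?y : Dec (Fixed y)) →
               ∃ λ q → indicator rep? * count (y ∼?_) ≡ indicator fixed?y + q * p
        term y (no _)   (no _)     = 0 , refl
        term y (no ¬rep) (yes fixedy) = contradiction (fixed⇒IsRep fixedy) ¬rep
        term y (yes ((Xy , _) , _)) fixed?y with ∣p^k⇒≡1⊎p∣ k (orbit-size∣p^k Xy) | fixed?y
        ... | inj₁ size≡1 | yes _ = 0 , trans (+-identityʳ _) size≡1
        ... | inj₁ size≡1 | no ¬fixed = contradiction (orbit-size-1⇒fixed Xy size≡1) ¬fixed
        ... | inj₂ (divides q size≡q*p) | no _ = q , trans (+-identityʳ _) size≡q*p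
        ... | inj₂ (divides q size≡q*p) | yes fixedy = contradiction (divides q (trans (sym size≡1) size≡q*p)) p∤1
          where
          size≡1 : count (y ∼?_) ≡ 1
          size≡1 = trans (count-cong (y ∼?_) (y ≟_) (fixed⇒orbit≐singleton fixedy)) (count-singleton y)
        q : Fin m → ℕ
        q y = proj₁ (term y (IsRep? y) (fixed? y))

  open GroupPowers group using (_^_; ^-+; module Period)

  ^-gap : ∀ g {i j} → i < j → g ^ i ≡ g ^ j → ∃ λ u → u < j × g ^ suc u ≡ ε
  ^-gap g {i} {suc j} (s≤s i≤j) gⁱ≡gʲ = j ∸ i , s≤s (m∸n≤m j i) , identityʳ-unique (g ^ i) _ (begin
    g ^ i ∙ g ^ suc (j ∸ i)   ≡⟨ ^-+ g i (suc (j ∸ i)) ⟨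
    g ^ (i + suc (j ∸ i))     ≡⟨ cong (g ^_) (trans (+-suc i (j ∸ i)) (cong suc (m+[n∸m]≡n i≤j))) ⟩
    g ^ suc j                 ≡⟨ gⁱ≡gʲ ⟨
    g ^ i                     ∎)
    where open ≡-Reasoning

  module Order (g : Fin n) where
    private
      Aperiodic : Pred (Fin n) 0ℓ
      Aperiodic t = g ^ suc (toℕ t) ≢ ε

      not-aperiodic : ¬ (∀ t → Aperiodic t)
      not-aperiodic aperiodic
        with i , j , i<j , gⁱ≡gʲ ← pigeonhole (n<1+n n) (λ (i : Fin (suc n)) → g ^ toℕ i)
        with u , u<j , gᵘ⁺¹≡ε ← ^-gap g i<j gⁱ≡gʲ
        = aperiodic (fromℕ< u<n) (subst (λ v → g ^ suc v ≡ ε) (sym (toℕ-fromℕ< u<n)) gᵘ⁺¹≡ε)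
        where u<n = <-≤-trans u<j (toℕ≤pred[n] j)

      least-period : ∃ λ t → ¬ Aperiodic t × ((s : Fin′ t) → Aperiodic (inject s))
      least-period = ¬∀⟶∃¬-smallest n Aperiodic (λ t → ¬? (g ^ suc (toℕ t) ≟ ε)) not-aperiodic

    order : ℕ
    order = suc (toℕ (proj₁ least-period))

    ^-order : g ^ order ≡ ε
    ^-order = decidable-stable (g ^ order ≟ ε) (proj₁ (proj₂ least-period))

    open Period {d = order} ^-order using (cyclic-isSubgroup; ^-multiple) public

    private
      distinct-below-order : ∀ {i j : Fin order} → i Fin.< j → g ^ toℕ i ≢ g ^ toℕ j
      distinct-below-order {j = j} i<j gⁱ≡gʲ with u , u<j , gᵘ⁺¹≡ε ← ^-gap g i<j gⁱ≡gʲ =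
        proj₂ (proj₂ least-period) (fromℕ< u<t) (subst (λ v → g ^ suc v ≡ ε) (sym toℕ-s≡u) gᵘ⁺¹≡ε)
        where
        u<t = <-≤-trans u<j (toℕ≤pred[n] j)
        toℕ-s≡u = trans (toℕ-inject (fromℕ< u<t)) (toℕ-fromℕ< u<t)

    ^-injective : Injective _≡_ _≡_ (λ (i : Fin order) → g ^ toℕ i)
    ^-injective {i} {j} gⁱ≡gʲ with Finₚ.<-cmp i j
    ... | tri< i<j _ _ = contradiction gⁱ≡gʲ (distinct-below-order i<j)
    ... | tri≈ _ i≡j _ = i≡j
    ... | tri> _ _ j<i = contradiction (sym gⁱ≡gʲ) (distinct-below-order j<i)

    order∣n : order ∣ n
    order∣n = subst (_∣ n) (count-image-injective (λ i → g ^ toℕ i) ^-injective)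
                            (Cosets.order∣n (image? (λ i → g ^ toℕ i)) cyclic-isSubgroup)

  ^-card≡ε : ∀ g → g ^ n ≡ ε
  ^-card≡ε g = ^-multiple-of-order (Order.order∣n g)
    where
    ^-multiple-of-order : Order.order g ∣ n → g ^ n ≡ ε
    ^-multiple-of-order (divides q n≡q*order) = trans (cong (g ^_) n≡q*order) (Order.^-multiple g q)

  module Normaliser {M : Pred (Fin n) 0ℓ} (M? : Decidable M) (M-sub : Subgroup M) where
    open IsSubgroupPred M-sub

    Normalises : Pred (Fin n) 0ℓ
    Normalises x = ∀ a → M a → M (x ⁻¹ ∙ a ∙ x)

    normalises? : Decidable Normalises
    normalises? x = all? (λ a → M? a →-dec M? (x ⁻¹ ∙ a ∙ x))

    -- x⁻¹Mx ⊆ M and |x⁻¹Mx| = |M| give x⁻¹Mx = M.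
    normalises⇒conjugate⁻¹ : ∀ {x} → Normalises x → ∀ a → M a → M (x ∙ a ∙ x ⁻¹)
    normalises⇒conjugate⁻¹ {x} x-norm a Ma = conjugate-reflects (subst M (sym cancel) Ma)
      where
      conjugate-count : count (λ b → M? (x ⁻¹ ∙ b ∙ x)) ≡ count M?
      conjugate-count = trans (count-permute (M? ∘ (_∙ x)) (translationˡ (x ⁻¹))) (count-permute M? (translationʳ x))
      conjugate-reflects : ∀ {b} → M (x ⁻¹ ∙ b ∙ x) → M b
      conjugate-reflects = count-≥⇒⊇ M? (λ b → M? (x ⁻¹ ∙ b ∙ x)) (x-norm _) (≤-reflexive conjugate-count)
      cancel : x ⁻¹ ∙ (x ∙ a ∙ x ⁻¹) ∙ x ≡ a
      cancel = begin
        x ⁻¹ ∙ (x ∙ a ∙ x ⁻¹) ∙ x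
          ≡⟨ solve 3 (λ x x⁻¹ a → (x⁻¹ ⊕ ((x ⊕ a) ⊕ x⁻¹)) ⊕ x ⊜ (x⁻¹ ⊕ (x ⊕ a)) ⊕ (x⁻¹ ⊕ x)) refl x (x ⁻¹) a ⟩
        x ⁻¹ ∙ (x ∙ a) ∙ (x ⁻¹ ∙ x)
          ≡⟨ cong₂ _∙_ (\\-leftDividesʳ x a) (inverseˡ x) ⟩
        a ∙ ε
          ≡⟨ identityʳ a ⟩
        a
          ∎
        where open ≡-Reasoning

    normaliser-isSubgroup : Subgroup Normalises
    normaliser-isSubgroup = record
      { ε∈       = λ a Ma → subst M (sym (ε-conjugate a)) Ma
      ; ∙-closed = λ {x} {y} x-norm y-norm a Ma → subst M (sym (product-conjugate x y a)) (y-norm _ (x-norm a Ma))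
      ; ⁻¹-closed = λ {x} x-norm a Ma → subst M (cong (λ x′ → x′ ∙ a ∙ x ⁻¹) (sym (⁻¹-involutive x)))
                                                 (normalises⇒conjugate⁻¹ x-norm a Ma)
      }
      where
      open ≡-Reasoning
      ε-conjugate : ∀ a → ε ⁻¹ ∙ a ∙ ε ≡ a
      ε-conjugate a = trans (identityʳ _) (trans (cong (_∙ a) ε⁻¹≈ε) (identityˡ a))
      product-conjugate : ∀ x y a → (x ∙ y) ⁻¹ ∙ a ∙ (x ∙ y) ≡ y ⁻¹ ∙ (x ⁻¹ ∙ a ∙ x) ∙ y
      product-conjugate x y a = begin
        (x ∙ y) ⁻¹ ∙ a ∙ (x ∙ y)
          ≡⟨ cong (λ z → z ∙ a ∙ (x ∙ y)) (⁻¹-anti-homo-∙ x y) ⟩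
        y ⁻¹ ∙ x ⁻¹ ∙ a ∙ (x ∙ y)
          ≡⟨ solve 5 (λ x y x⁻¹ y⁻¹ a → ((y⁻¹ ⊕ x⁻¹) ⊕ a) ⊕ (x ⊕ y) ⊜ (y⁻¹ ⊕ ((x⁻¹ ⊕ a) ⊕ x)) ⊕ y)
                     refl x y (x ⁻¹) (y ⁻¹) a ⟩
        y ⁻¹ ∙ (x ⁻¹ ∙ a ∙ x) ∙ y
          ∎

    M⊆normaliser : M ⊆ Normalises
    M⊆normaliser Mx a Ma = ∙-closed (∙-closed (⁻¹-closed Mx) Ma) Mx

  module Quotient {M : Pred (Fin n) 0ℓ} (M? : Decidable M) (M-sub : Subgroup M) (M-normal : Normal M) where
    open IsSubgroupPred M-sub
    open Cosets M? M-sub public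

    ∼-∙ʳ : ∀ a {x y} → x ∼ y → x ∙ a ∼ y ∙ a
    ∼-∙ʳ a {x} {y} x∼y = subst M (sym (begin
      (x ∙ a) ⁻¹ ∙ (y ∙ a)
        ≡⟨ cong (_∙ (y ∙ a)) (⁻¹-anti-homo-∙ x a) ⟩
      a ⁻¹ ∙ x ⁻¹ ∙ (y ∙ a)
        ≡⟨ solve 4 (λ a⁻¹ x⁻¹ y a → (a⁻¹ ⊕ x⁻¹) ⊕ (y ⊕ a) ⊜ (a⁻¹ ⊕ (x⁻¹ ⊕ y)) ⊕ a) refl (a ⁻¹) (x ⁻¹) y a ⟩
      a ⁻¹ ∙ (x ⁻¹ ∙ y) ∙ a
        ∎)) (M-normal a _ x∼y)
      where open ≡-Reasoning

    ∙-cong : ∀ {x x′ y y′} → x ∼ x′ → y ∼ y′ → x ∙ y ∼ x′ ∙ y′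
    ∙-cong {x′ = x′} {y = y} x∼x′ y∼y′ = ∼-trans (∼-∙ʳ y x∼x′) (∼-∙ˡ x′ y∼y′)

    ⁻¹-cong : ∀ {x y} → x ∼ y → x ⁻¹ ∼ y ⁻¹
    ⁻¹-cong {x} {y} x∼y = subst₂ _∼_ (//-rightDividesʳ y (x ⁻¹)) x⁻¹x∙y⁻¹≡y⁻¹ (∼-∙ʳ (y ⁻¹) (∼-∙ˡ (x ⁻¹) (∼-sym x∼y)))
      where
      x⁻¹x∙y⁻¹≡y⁻¹ : x ⁻¹ ∙ x ∙ y ⁻¹ ≡ y ⁻¹
      x⁻¹x∙y⁻¹≡y⁻¹ = trans (cong (_∙ y ⁻¹) (inverseˡ x)) (identityˡ (y ⁻¹))

    quotient : Group 0ℓ 0ℓ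
    quotient = record
      { Carrier = Fin n
      ; _≈_     = _∼_
      ; _∙_     = _∙_
      ; ε       = ε
      ; _⁻¹     = _⁻¹
      ; isGroup = record
        { isMonoid = record
          { isSemigroup = record
            { isMagma = record
              { isEquivalence = record { refl = ∼-refl ; sym = ∼-sym ; trans = ∼-trans }
              ; ∙-cong        = ∙-cong
              }
            ; assoc = λ x y z → ≡⇒∼ (assoc x y z)
            }
          ; identity = (λ x → ≡⇒∼ (identityˡ x)) , (λ x → ≡⇒∼ (identityʳ x))
          }
        ; inverse = (λ x → ≡⇒∼ (inverseˡ x)) , (λ x → ≡⇒∼ (inverseʳ x))
        ; ⁻¹-cong = ⁻¹-cong
        }
      }

  module _ {S : Pred (Fin n) 0ℓ} (S? : Decidable S) where

    toSubset-isSubgroup : Subgroup S → IsSubgroup G (toSubset S?)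
    toSubset-isSubgroup S-sub =
      ∈toSubset⁺ S? ε∈ ,
      (λ _ _ x∈ y∈ → ∈toSubset⁺ S? (∙-closed (∈toSubset⁻ S? x∈) (∈toSubset⁻ S? y∈))) ,
      (λ _ x∈ → ∈toSubset⁺ S? (⁻¹-closed (∈toSubset⁻ S? x∈)))
      where open IsSubgroupPred S-sub

    toSubset-isNormal : Normal S → IsNormal G (toSubset S?)
    toSubset-isNormal normal g a a∈ = ∈toSubset⁺ S?
      (subst S (cong (λ g′ → g′ ∙ a ∙ g ⁻¹) (⁻¹-involutive g)) (normal (g ⁻¹) a (∈toSubset⁻ S? a∈)))

module PGroup (G : FiniteGroup) {p : ℕ} (p-prime : Prime p) (k : ℕ) (n≡p^k : FiniteGroup.n G ≡ p ℕ.^ k) where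
  open FiniteGroup G using (n)
  open FiniteGroupTheory G
  open PrimePowers p-prime
  open GroupPowers group using (_^_; ^-*)
  open Group group using (assoc; identityˡ; identityʳ)
  open import Algebra.Properties.Group group using (⁻¹-anti-homo-∙; ⁻¹-involutive)

  module _ {M : Pred (Fin n) 0ℓ} (M? : Decidable M) (M-sub : Subgroup M) (M-proper : ∃ λ x → ¬ M x) where
    open IsSubgroupPred M-sub
    open Cosets M? M-sub

    order∣p^k : count M? ∣ p ℕ.^ k
    order∣p^k = subst (count M? ∣_) n≡p^k order∣n

    p∣index : p ∣ index
    p∣index with ∣p^k⇒≡1⊎p∣ k (subst (index ∣_) n≡p^k index∣n)
    ... | inj₁ index≡1 = contradiction (index≡1⇒total index≡1 (proj₁ M-proper)) (proj₂ M-proper)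
    ... | inj₂ p∣index = p∣index

    private
      act : Fin n → Fin n → Fin n
      act a r = rep (a ∙ r)

      act-ε : ∀ {r} → IsRep r → act ε r ≡ r
      act-ε {r} (_ , rep-r≡r) = trans (cong rep (identityˡ r)) rep-r≡r

      act-∙ : ∀ {a b r} → M a → M b → IsRep r → act (a ∙ b) r ≡ act a (act b r)
      act-∙ {a} {b} {r} _ _ _ = rep-cong (∼-trans (≡⇒∼ (assoc a b r)) (∼-∙ˡ a (rep-∼ ∼-refl)))

      act-IsRep : ∀ {a r} → M a → IsRep r → IsRep (act a r)
      act-IsRep _ _ = rep-IsRep ∼-refl

      open module OnCosets = Action M? M-sub IsRep? act act-ε act-∙ act-IsRep
        using (Fixed; fixed?; fixedPoints-mod-p)

      r₀ : Fin n
      r₀ = rep ε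

      M-r₀ : M r₀
      M-r₀ = ε∼⇒∈ (rep-∼ ∼-refl)

      fixed-r₀ : Fixed r₀
      fixed-r₀ = rep-IsRep ∼-refl , λ a Ma → rep-cong (∼-sym (∈⇒ε∼ (∙-closed Ma M-r₀)))

      p∣fixed : p ∣ count fixed?
      p∣fixed = p∣fixed-from (fixedPoints-mod-p p-prime k order∣p^k)
        where
        p∣fixed-from : (∃ λ q → index ≡ count fixed? + q * p) → p ∣ count fixed?
        p∣fixed-from (q , index≡fixed+q*p) =
          ∣m+n∣m⇒∣n (subst (p ∣_) (trans index≡fixed+q*p (+-comm _ (q * p))) p∣index) (n∣m*n q)

      other-fixed : ∃ λ r → Fixed r × r₀ ≢ r
      other-fixed = 0<count⇒∃ (fixed? ∩? ∁? (r₀ ≟_))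
        (n≢0⇒n>0 λ none → p∤1 (subst (p ∣_) (only-r₀⇒count≡1 none) p∣fixed))
        where
        only-r₀⇒count≡1 : count (fixed? ∩? ∁? (r₀ ≟_)) ≡ 0 → count fixed? ≡ 1
        only-r₀⇒count≡1 none = begin
          count fixed?
            ≡⟨ count-split fixed? (r₀ ≟_) ⟩
          count (fixed? ∩? (r₀ ≟_)) + count (fixed? ∩? ∁? (r₀ ≟_))
            ≡⟨ cong₂ _+_ (count-cong (fixed? ∩? (r₀ ≟_)) (r₀ ≟_) (proj₂ , λ { refl → fixed-r₀ , refl })) none ⟩
          count (r₀ ≟_) + 0
            ≡⟨ cong (_+ 0) (count-singleton r₀) ⟩
          1
            ∎
          where open ≡-Reasoning

    normaliser-grows : ∃ λ r → ¬ M r × Normaliser.Normalises M? M-sub r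
    normaliser-grows = grows other-fixed
      where
      grows : (∃ λ r → Fixed r × r₀ ≢ r) → ∃ λ r → ¬ M r × Normaliser.Normalises M? M-sub r
      grows (r , ((_ , rep-r≡r) , fixed) , r₀≢r) = r , r∉M , r-normalises
        where
        r∉M : ¬ M r
        r∉M Mr = r₀≢r (trans (rep-cong (∈⇒ε∼ Mr)) rep-r≡r)
        r-normalises : ∀ a → M a → M (r ⁻¹ ∙ a ∙ r)
        r-normalises a Ma = subst M (trans (cong (_∙ r) (⁻¹-anti-homo-∙ (a ⁻¹) r)) (cong (λ b → r ⁻¹ ∙ b ∙ r) (⁻¹-involutive a)))
          (rep-injective ∼-refl ∼-refl (trans (fixed (a ⁻¹) (⁻¹-closed Ma)) (sym rep-r≡r)))

    private
      M[g^pᵏ] : ∀ g → M (g ^ (p ℕ.^ k))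
      M[g^pᵏ] g = subst M (sym (trans (cong (g ^_) (sym n≡p^k)) (^-card≡ε g))) ε∈

    ∃∉-with-p-th-power-∈ : ∃ λ h → ¬ M h × M (h ^ p)
    ∃∉-with-p-th-power-∈ =
      let g , ¬Mg = M-proper
          t , ¬M[g^pᵗ] , M[g^pᵗ⁺¹] = crossing (λ t → M? (g ^ (p ℕ.^ t))) k (¬Mg ∘ subst M (identityʳ g)) (M[g^pᵏ] g)
      in g ^ (p ℕ.^ t) , ¬M[g^pᵗ] , subst M (^-* g p (p ℕ.^ t)) M[g^pᵗ⁺¹]

module Involution (G : FiniteGroup) {p : ℕ} (p-prime : Prime p) (p-odd : p % 2 ≡ 1)
                  (k : ℕ) (n≡p^k : FiniteGroup.n G ≡ p ℕ.^ k)
                  (c : Fin (FiniteGroup.n G) → Fin (FiniteGroup.n G))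
                  (c-hom : ∀ x y → c (FiniteGroup._∙_ G x y) ≡ FiniteGroup._∙_ G (c x) (c y))
                  (c-invol : ∀ x → c (c x) ≡ x) where
  open FiniteGroup G using (n)
  open FiniteGroupTheory G
  open PGroup G p-prime k n≡p^k
  open PrimePowers p-prime
  open GroupPowers group using (_^_)
  open Group group using (assoc; identityʳ; inverseʳ)
  open import Algebra.Properties.Group group
    using (inverseʳ-unique; identityʳ-unique; ⁻¹-anti-homo-∙; ⁻¹-involutive; \\-leftDividesˡ; //-rightDividesʳ)

  instance
    p≢0 : NonZero p
    p≢0 = prime⇒nonZero p-prime

  c-ε : c ε ≡ ε
  c-ε = identityʳ-unique (c ε) (c ε) (trans (sym (c-hom ε ε)) (cong c (identityʳ ε)))

  c-⁻¹ : ∀ x → c (x ⁻¹) ≡ c x ⁻¹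
  c-⁻¹ x = inverseʳ-unique (c x) (c (x ⁻¹)) (trans (sym (c-hom x (x ⁻¹))) (trans (cong c (inverseʳ x)) c-ε))

  c-conjugate : ∀ x a → c (x ⁻¹ ∙ a ∙ x) ≡ c x ⁻¹ ∙ c a ∙ c x
  c-conjugate x a = trans (c-hom _ x) (cong (_∙ c x) (trans (c-hom (x ⁻¹) a) (cong (_∙ c a) (c-⁻¹ x))))

  record Admissible : Set₁ where
    field
      Member   : Pred (Fin n) 0ℓ
      member?  : Decidable Member
      subgroup : Subgroup Member
      c-closed : ∀ {x} → Member x → Member (c x)
      fixed⊆   : ∀ {x} → c x ≡ x → Member x
      proper   : ∃ λ x → ¬ Member x

    size : ℕ
    size = count member?

  fixedSubgroup : (∃ λ x → c x ≢ x) → Admissible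
  fixedSubgroup moved = record
    { Member   = λ x → c x ≡ x
    ; member?  = λ x → c x ≟ x
    ; subgroup = record
      { ε∈       = c-ε
      ; ∙-closed = λ {x} {y} cx≡x cy≡y → trans (c-hom x y) (cong₂ _∙_ cx≡x cy≡y)
      ; ⁻¹-closed = λ {x} cx≡x → trans (c-⁻¹ x) (cong _⁻¹ cx≡x)
      }
    ; c-closed = cong c
    ; fixed⊆   = λ cx≡x → cx≡x
    ; proper   = moved
    }

  module _ (H : Admissible) where
    open Admissible H
    open Cosets member? subgroup

    c-cong : ∀ {x y} → x ∼ y → c x ∼ c y
    c-cong {x} {y} x∼y = subst Member (trans (c-hom (x ⁻¹) y) (cong (_∙ c y) (c-⁻¹ x))) (c-closed x∼y)

    private
      coset-odd : ∀ z → ¬ 2 ∣ count (z ∼?_)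
      coset-odd z = subst (λ s → ¬ 2 ∣ s) (sym (coset-size z)) (∣p^k⇒odd p-odd k (order∣p^k member? subgroup proper))

    -- c restricts to an involution of the coset zH, of odd size, so it fixes some f ∈ zH ∩ G⁺ ⊆ H.
    stable-coset⇒member : ∀ {z} → z ∼ c z → Member z
    stable-coset⇒member {z} z∼cz =
      let f , z∼f , cf≡f = involution-fixedPoint (z ∼?_) c c-invol (λ z∼y → ∼-trans z∼cz (c-cong z∼y)) (coset-odd z)
      in ε∼⇒∈ (∼-trans (∈⇒ε∼ (fixed⊆ cf≡f)) (∼-sym z∼f))

    open Normaliser member? subgroup

    normaliser-c-closed : ∀ {x} → Normalises x → Normalises (c x)
    normaliser-c-closed {x} x-norm a Ma =
      subst Member (trans (c-conjugate x (c a)) (cong (λ b → c x ⁻¹ ∙ b ∙ c x) (c-invol a)))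
                   (c-closed (x-norm (c a) (c-closed Ma)))

    normal-or-grows : Normal Member ⊎ ∃ λ (H′ : Admissible) → size < Admissible.size H′
    normal-or-grows with all? normalises?
    ... | yes normal  = inj₁ normal
    ... | no ¬normal =
      let r , ¬Mr , r-norm = normaliser-grows member? subgroup proper
      in inj₂ (normaliser , count-mono-< member? normalises? M⊆normaliser r-norm ¬Mr)
      where
      normaliser : Admissible
      normaliser = record
        { Member   = Normalises
        ; member?  = normalises?
        ; subgroup = normaliser-isSubgroup
        ; c-closed = normaliser-c-closed
        ; fixed⊆   = M⊆normaliser ∘ fixed⊆
        ; proper   = ¬∀⟶∃¬ n Normalises normalises? ¬normal
        }

  module _ (H : Admissible) (normal : Normal (Admissible.Member H)) where
    open Admissible H
    open Quotient member? subgroup normal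
    open Group quotient using (setoid)
    open import Algebra.Properties.Group quotient using (x∙y⁻¹≈ε⇒x≈y)
    open GroupPowers quotient using (module Period)

    ψ : Fin n → Fin n
    ψ x = x ⁻¹ ∙ c x

    ψ-injective : ∀ {x y} → ψ x ∼ ψ y → x ∼ y
    ψ-injective {x} {y} ψx∼ψy =
      ∼-sym (x∙y⁻¹≈ε⇒x≈y y x (∼-sym (∈⇒ε∼ (stable-coset⇒member H yx⁻¹∼c[yx⁻¹]))))
      where
      open import Relation.Binary.Reasoning.Setoid setoid
      yx⁻¹∼c[yx⁻¹] : y ∙ x ⁻¹ ∼ c (y ∙ x ⁻¹)
      yx⁻¹∼c[yx⁻¹] = begin
        y ∙ x ⁻¹
          ≡⟨ cong (y ∙_) (//-rightDividesʳ (c x) (x ⁻¹)) ⟨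
        y ∙ (ψ x ∙ c x ⁻¹)
          ≈⟨ ∙-cong ∼-refl (∙-cong ψx∼ψy ∼-refl) ⟩
        y ∙ (ψ y ∙ c x ⁻¹)
          ≡⟨ trans (sym (assoc y (ψ y) (c x ⁻¹))) (cong (_∙ c x ⁻¹) (\\-leftDividesˡ y (c y))) ⟩
        c y ∙ c x ⁻¹
          ≡⟨ trans (c-hom y (x ⁻¹)) (cong (c y ∙_) (c-⁻¹ x)) ⟨
        c (y ∙ x ⁻¹)
          ∎

    -- ψ is injective modulo H, hence surjective modulo H, and c inverts every ψ x.
    c-inverts : ∀ y → c y ∼ y ⁻¹
    c-inverts y = let x , ψx∼y = injective-mod⇒surjective-mod ∼-refl ψ ψ-injective y in begin
      c y                         ≈⟨ c-cong H (∼-sym ψx∼y) ⟩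
      c (ψ x)                     ≡⟨ trans (c-hom (x ⁻¹) (c x)) (cong₂ _∙_ (c-⁻¹ x) (c-invol x)) ⟩
      c x ⁻¹ ∙ x                  ≡⟨ trans (⁻¹-anti-homo-∙ (x ⁻¹) (c x)) (cong (c x ⁻¹ ∙_) (⁻¹-involutive x)) ⟨
      ψ x ⁻¹                      ≈⟨ ⁻¹-cong ψx∼y ⟩
      y ⁻¹                        ∎
      where open import Relation.Binary.Reasoning.Setoid setoid

    -- Cyclic is ⟨h⟩H, the cyclic subgroup of G/H generated by h.
    module Extension {h : Fin n} (¬Mh : ¬ Member h) (Mhᵖ : Member (h ^ p)) where
      open Period {d = p} (∼-sym (∈⇒ε∼ Mhᵖ)) using (Cyclic; ^∈Cyclic; Cyclic-resp; cyclic-isSubgroup)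

      private
        cyclic? : Decidable Cyclic
        cyclic? y = any? (λ i → h ^ toℕ i ∼? y)

        M⊆cyclic : ∀ {x} → Member x → Cyclic x
        M⊆cyclic Mx = Cyclic-resp (^∈Cyclic 0) (∈⇒ε∼ Mx)

        h∈cyclic : Cyclic h
        h∈cyclic = Cyclic-resp (^∈Cyclic 1) (≡⇒∼ (identityʳ h))

        cyclic-c-closed : ∀ {y} → Cyclic y → Cyclic (c y)
        cyclic-c-closed {y} y∈ = Cyclic-resp (IsSubgroupPred.⁻¹-closed cyclic-isSubgroup y∈) (∼-sym (c-inverts y))

        index≡p : (∀ y → Cyclic y) → index ≡ p
        index≡p total = ≤-antisym index≤p p≤index
          where
          rep-of-power : Fin p → Fin n
          rep-of-power i = rep (h ^ toℕ i)
          IsRep⊆image : IsRep ⊆ Image rep-of-power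
          IsRep⊆image {y} (_ , rep-y≡y) = let i , hⁱ∼y = total y in i , trans (rep-cong hⁱ∼y) rep-y≡y
          index≤p : index ≤ p
          index≤p = ≤-trans (count-mono IsRep? (image? rep-of-power) IsRep⊆image) (count-image-≤ rep-of-power)
          p≤index : p ≤ index
          p≤index = ∣⇒≤ {{>-nonZero (P⇒0<count IsRep? (rep-IsRep (∼-refl {ε})))}} (p∣index member? subgroup proper)

      index-p-or-grows : n ≡ p * size ⊎ ∃ λ (H′ : Admissible) → size < Admissible.size H′
      index-p-or-grows with all? cyclic?
      ... | yes total = inj₁ (trans lagrange (cong (_* size) (index≡p total)))
      ... | no ¬total = inj₂ (extension , count-mono-< member? cyclic? M⊆cyclic h∈cyclic ¬Mh)
        where
        extension : Admissible
        extension = record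
          { Member   = Cyclic
          ; member?  = cyclic?
          ; subgroup = cyclic-isSubgroup
          ; c-closed = cyclic-c-closed
          ; fixed⊆   = M⊆cyclic ∘ fixed⊆
          ; proper   = ¬∀⟶∃¬ n Cyclic cyclic? ¬total
          }

    index-p-or-grows : n ≡ p * size ⊎ ∃ λ (H′ : Admissible) → size < Admissible.size H′
    index-p-or-grows = let _ , ¬Mh , Mhᵖ = ∃∉-with-p-th-power-∈ member? subgroup proper
                       in Extension.index-p-or-grows ¬Mh Mhᵖ

  grow : (H : Admissible) → (Normal (Admissible.Member H) × n ≡ p * Admissible.size H)
                          ⊎ ∃ λ (H′ : Admissible) → Admissible.size H < Admissible.size H′
  grow H = [ (λ normal → Sum.map₁ (normal ,_) (index-p-or-grows H normal)) , inj₂ ]′ (normal-or-grows H)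

  grow-to-normal-of-index-p : ∀ gap (H : Admissible) → n ≤ Admissible.size H + gap →
                      ∃ λ (H : Admissible) → Normal (Admissible.Member H) × n ≡ p * Admissible.size H
  grow-to-normal-of-index-p zero H n≤size =
    let x , x∉H = Admissible.proper H
    in contradiction (count-all (Admissible.member? H) (subst (n ≤_) (+-identityʳ _) n≤size) x) x∉H
  grow-to-normal-of-index-p (suc gap) H n≤size+gap = [ (H ,_) , larger ]′ (grow H)
    where
    larger : (∃ λ (H′ : Admissible) → Admissible.size H < Admissible.size H′) →
             ∃ λ (H : Admissible) → Normal (Admissible.Member H) × n ≡ p * Admissible.size H
    larger (H′ , size<size′) = grow-to-normal-of-index-p gap H′ (begin
      n                                  ≤⟨ n≤size+gap ⟩
      Admissible.size H + suc gap        ≡⟨ +-suc _ gap ⟩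
      suc (Admissible.size H) + gap      ≤⟨ +-monoˡ-≤ gap size<size′ ⟩
      Admissible.size H′ + gap           ∎)
      where open ≤-Reasoning

  normal-admissible-of-index-p : (∃ λ x → c x ≢ x) →
                                 ∃ λ (H : Admissible) → Normal (Admissible.Member H) × n ≡ p * Admissible.size H
  normal-admissible-of-index-p moved = grow-to-normal-of-index-p n (fixedSubgroup moved) (m≤n+m n _)

  toSubset-c-image : {S : Pred (Fin n) 0ℓ} (S? : Decidable S) → (∀ {x} → S x → S (c x)) →
                     ∀ x → (InImage G c (toSubset S?) x → x ∈ toSubset S?) × (x ∈ toSubset S? → InImage G c (toSubset S?) x)
  toSubset-c-image S? c-closed x =
    (λ { (y , y∈ , refl) → ∈toSubset⁺ S? (c-closed (∈toSubset⁻ S? y∈)) }) ,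
    (λ x∈ → c x , ∈toSubset⁺ S? (c-closed (∈toSubset⁻ S? x∈)) , c-invol x)

lemma4p1 : (p : ℕ) → Prime p → p % 2 ≡ 1
    → (G : FiniteGroup) → IsPGroup G p
    → (c : Fin (FiniteGroup.n G) → Fin (FiniteGroup.n G))
    → IsAutomorphism G c → HasOrder2 G c
    → ¬ (∀ g → InFixed G c g)
    → Σ (Subset (FiniteGroup.n G)) λ H →
        IsSubgroup G H
        × (∀ g → InFixed G c g → g ∈ H)
        × (FiniteGroup.n G ≡ p * ∣ H ∣)
        × IsNormal G H
        × (∀ x → (InImage G c H x → x ∈ H) × (x ∈ H → InImage G c H x))
lemma4p1 p p-prime p-odd G (k , n≡p^k) c (c-hom , _) (c-invol , _) G⁺≢G =
  let H , H-normal , n≡p*|H| = normal-admissible-of-index-p (¬∀⟶∃¬ n _ (λ x → c x ≟ x) G⁺≢G)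
      open Admissible H
  in toSubset member? ,
     toSubset-isSubgroup member? subgroup ,
     (λ _ → ∈toSubset⁺ member? ∘ fixed⊆) ,
     trans n≡p*|H| (cong (p *_) (sym (∣toSubset∣ member?))) ,
     toSubset-isNormal member? H-normal ,
     toSubset-c-image member? c-closed
  where
  open FiniteGroup G using (n)
  open FiniteGroupTheory G using (toSubset-isSubgroup; toSubset-isNormal)
  open Involution G p-prime p-odd k n≡p^k c c-hom c-invol
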